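{- Let $\mathcal{P}$ be the output of Algorithm LAP (defined in the context) with threshold $\rho\ge1$ on real instance $\mathcal{J}$ and prediction $\hat{\mathcal{J}}$, and let $$\eta=\max_{t\in[T]}\frac{W(\textsc{Opt}(\mathcal{J}_{\le t})^{(\le t)})}{W(\hat{\mathcal{S}}(\mathcal{J})^{(\le t)})}.$$ If $\eta\le\rho$, then LAP is $\eta$-competitive: $W(\textsc{Opt}(\mathcal{J}))\le \eta\,W(\mathcal{P})$.
   Context: Problem: an instance is a collection $\mathcal{J}$ of unit-length jobs $j=(r_j,d_j,w_j)$ (integer release time, integer deadline, nonnegative weight, all weights distinct), revealed online at their release times. Time is discrete with horizon $T$, $[T]$ the set of time steps; at each time $t$ at most one job is processed and job $j$ may be processed at $t$ only if $r_j\le t\le d_j-1$; the goal is to maximize total processed weight. For a schedule $\mathcal{S}$: $W$ is total weight, $\mathcal{S}^{(t)}$ the job processed at time $t$, $\mathcal{S}^{(\le t)}$ the jobs processed in $[0,t]$ (zero-weight dummy jobs when nothing is processed). $\mathcal{J}_{\le t}$: jobs with release time $\le t$. $\mathcal{D}(t,\mathcal{J})$: jobs with $d_j<t+1$ not yet processed. Job $j$ dominates $j'$ if $w_j>w_{j'}$ and $d_j\le d_{j'}$; a canonical schedule processes at each step the earliest-deadline released, unprocessed, undominated job among its jobs; $\textsc{Opt}(\mathcal{I})$ is a canonical optimal schedule for instance $\mathcal{I}$. The algorithm receives at time $0$ a predicted instance $\hat{\mathcal{J}}$. A set of choices $\mathcal{S}=(\mathcal{S}_1,\dots,\mathcal{S}_T)$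 specifies which job to process at each time; $\mathcal{S}(\mathcal{J})$ is the schedule of jobs of $\mathcal{J}$ obtained by following these choices (zero-weight dummy jobs when there is no corresponding job). Algorithm LAP: input $\hat{\mathcal{J}}$, an online algorithm $\textsc{OnlineAlg}$ for the problem (without predictions), and threshold $\rho\ge1$. It computes the choices $\hat{\mathcal{S}}$ of an optimal schedule for $\hat{\mathcal{J}}$ ($\hat{\mathcal{S}}(\hat{\mathcal{J}})=\textsc{Opt}(\hat{\mathcal{J}})$), sets $\mathcal{P}=\emptyset$, and for each time $t$: if $\hat{\mathcal{S}}(\mathcal{J})^{(t)}\notin\mathcal{P}$ and $W(\textsc{Opt}(\mathcal{J}_{\le t})^{(\le t)})/W(\mathcal{P}\cup\{\hat{\mathcal{S}}(\mathcal{J})^{(t)}\})\le\rho$, it processes $\hat{\mathcal{S}}(\mathcal{J})^{(t)}$ (adds it to $\mathcal{P}$); otherwise it processes (adds to $\mathcal{P}$) the job $\textsc{OnlineAlg}(\mathcal{J}\setminus(\mathcal{P}\cup\mathcal{D}(t,\mathcal{J})))^{(t)}$ that $\textsc{OnlineAlg}$ processes at time $t$ on the remaining unprocessed, unexpired jobs. It returns $\mathcal{P}$.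
   Formalization: The job weights, the threshold ρ and the error η are rational numbers rather than real numbers. -}

module Defs where

open import Data.Nat as ℕ using (ℕ; zero; suc)
import Data.Nat.Properties as ℕP
open import Data.Rational as ℚ using (ℚ; 0ℚ; 1ℚ; _+_; _*_)
import Data.Rational.Properties as ℚP
open import Data.Product using (_×_; _,_; proj₁; proj₂; Σ; ∃)
import Data.Product.Properties as ΣP
open import Data.Maybe using (Maybe; just; nothing)
open import Data.List using (List; []; _∷_; filter)
open import Data.Empty using (⊥)
open import Relation.Nullary using (¬_; yes; no; _×-dec_)
open import Relation.Nullary.Decidable using (¬?)
open import Relation.Binary.PropositionalEquality using (_≡_)
open import Relation.Binary.Definitions using (DecidableEquality)

-- Jobs
-- A unit-length job j = (r_j , d_j , w_j): integer release time,
-- integer deadline, (rational) weight.  Jobs are identified by their triple.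

Job : Set
Job = ℕ × ℕ × ℚ

rel : Job → ℕ
rel j = proj₁ j

dl : Job → ℕ
dl j = proj₁ (proj₂ j)

wt : Job → ℚ
wt j = proj₂ (proj₂ j)

_≟J_ : DecidableEquality Job
_≟J_ = ΣP.≡-dec ℕP._≟_ (ΣP.≡-dec ℕP._≟_ ℚP._≟_)

open import Data.List.Membership.DecPropositional _≟J_ public
  using (_∈_; _∉_; _∈?_; _∉?_)

Instance : Set
Instance = List Job

WellFormed : Instance → Set
WellFormed I =
  (∀ j → j ∈ I → 0ℚ ℚ.≤ wt j) ×
  (∀ j j' → j ∈ I → j' ∈ I → wt j ≡ wt j' → j ≡ j')

released≤ : ℕ → Instance → Instance
released≤ t I = filter (λ j → rel j ℕ.≤? t) I

-- Schedules: job processed at each time step ('nothing' = zero-weight dummy)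

Sched : Set
Sched = ℕ → Maybe Job

wtM : Maybe Job → ℚ
wtM nothing  = 0ℚ
wtM (just j) = wt j

Wupto : ℕ → Sched → ℚ
Wupto zero    S = 0ℚ
Wupto (suc n) S = Wupto n S + wtM (S n)

-- W(S) for horizon T (time steps [T] = {0,…,T-1})
W : ℕ → Sched → ℚ
W T S = Wupto T S

W≤ : ℕ → Sched → ℚ
W≤ t S = Wupto (suc t) S

Wset : List Job → ℚ
Wset []      = 0ℚ
Wset (j ∷ P) = wt j + Wset P

Feasible : ℕ → Instance → Sched → Set
Feasible T I S =
  (∀ t j → S t ≡ just j → (j ∈ I) × (rel j ℕ.≤ t) × (t ℕ.< dl j) × (t ℕ.< T)) ×
  (∀ t t' j → S t ≡ just j → S t' ≡ just j → t ≡ t')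

Optimal : ℕ → Instance → Sched → Set
Optimal T I S = Feasible T I S × (∀ S' → Feasible T I S' → W T S' ℚ.≤ W T S)

Dominates : Job → Job → Set
Dominates j j' = (wt j' ℚ.< wt j) × (dl j ℕ.≤ dl j')

Avail : ℕ → Sched → ℕ → Job → Set
Avail T S t j =
  (∃ λ t' → (t' ℕ.< T) × (S t' ≡ just j)) ×
  (rel j ℕ.≤ t) ×
  (∀ t' → t' ℕ.< t → ¬ (S t' ≡ just j))

Undominated : ℕ → Sched → ℕ → Job → Set
Undominated T S t j = ∀ j' → Avail T S t j' → ¬ Dominates j' j

Canonical : ℕ → Sched → Set
Canonical T S = ∀ t → t ℕ.< T →
  ((∃ λ j → Avail T S t j) →
     Σ Job λ j → (S t ≡ just j) × Avail T S t j × Undominated T S t j ×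
       (∀ j' → Avail T S t j' → Undominated T S t j' → dl j ℕ.≤ dl j')) ×
  (¬ (∃ λ j → Avail T S t j) → S t ≡ nothing)

IsCanonicalOpt : ℕ → (Instance → Sched) → Set
IsCanonicalOpt T opt = ∀ I → WellFormed I → Optimal T I (opt I) × Canonical T (opt I)

-- an (deterministic) online algorithm without predictions: a feasible
-- schedule for every instance, whose decisions up to time t depend only on
-- the jobs released up to time t
IsOnlineAlg : ℕ → (Instance → Sched) → Set
IsOnlineAlg T alg =
  (∀ I → WellFormed I → Feasible T I (alg I)) ×
  (∀ I I' t → (∀ j → (j ∈ I × rel j ℕ.≤ t → j ∈ I') × (j ∈ I' × rel j ℕ.≤ t → j ∈ I)) →
     ∀ t' → t' ℕ.≤ t → alg I t' ≡ alg I' t')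

follow : Sched → Instance → Sched
follow c J t with c t
... | nothing = nothing
... | just j with j ∈? J
...   | yes _ = just j
...   | no  _ = nothing

remaining : ℕ → Instance → List Job → Instance
remaining t J P = filter (λ j → ¬? (j ∈? P) ×-dec (t ℕ.<? dl j)) J

module LAP (T : ℕ) (J Ĵ : Instance) (alg opt : Instance → Sched) (ρ : ℚ) where

  Ŝ : Sched
  Ŝ = opt Ĵ

  ŜJ : Sched
  ŜJ = follow Ŝ J

  optW : ℕ → ℚ
  optW t = W≤ t (opt (released≤ t J))

  onlineStep : ℕ → List Job → List Job
  onlineStep t P with alg (remaining t J P) t
  ... | nothing = P
  ... | just j  = j ∷ P

  -- one step at time t ; the test  a / b ≤ ρ  is read as  a ≤ ρ · b
  step : ℕ → List Job → List Job
  step t P with ŜJ t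
  ... | nothing with optW t ℚ.≤? ρ * Wset P
  ...   | yes _ = P
  ...   | no  _ = onlineStep t P
  step t P | just j with j ∉? P ×-dec (optW t ℚ.≤? ρ * (Wset P + wt j))
  ...   | yes _ = j ∷ P
  ...   | no  _ = onlineStep t P

  run : ℕ → List Job
  run zero    = []
  run (suc n) = step n (run n)

  output : List Job
  output = run T

LAPoutput : ℕ → Instance → Instance → (Instance → Sched) → (Instance → Sched) → ℚ → List Job
LAPoutput T J Ĵ alg opt ρ = LAP.output T J Ĵ alg opt ρ

-- η = max_{t ∈ [T]} a_t / b_t, with a_t,b_t ≥ 0, read with the convention
-- a/b ≤ x ⇔ a ≤ x·b (so 0/0 imposes nothing and a/0 = ∞ for a > 0):
-- η is the least nonnegative upper bound of the ratios.
IsMaxRatio : ℕ → (ℕ → ℚ) → (ℕ → ℚ) → ℚ → Set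
IsMaxRatio T a b η =
  (0ℚ ℚ.≤ η) ×
  (∀ t → t ℕ.< T → a t ℚ.≤ η * b t) ×
  (∀ η' → 0ℚ ℚ.≤ η' → (∀ t → t ℕ.< T → a t ℚ.≤ η' * b t) → η ℚ.≤ η')

-- Since η ≤ ρ, at every time t the threshold test of LAP holds for the job
-- chosen by the prediction: W(Opt(J_{≤t})^{(≤t)}) ≤ η·W(Ŝ(J)^{(≤t)}) ≤ ρ·W(Ŝ(J)^{(≤t)}),
-- and W(Ŝ(J)^{(≤t)}) is exactly the weight of 𝒫 after accepting that job, by
-- induction on t (the job is not yet in 𝒫 because Opt(Ĵ) processes each job
-- once). So LAP outputs exactly the jobs of Ŝ(J). Finally Opt(J) is feasible for
-- J_{≤T-1} with horizon T, so W(Opt(J)) ≤ W(Opt(J_{≤T-1})^{(≤T-1)}) ≤ η·W(Ŝ(J)).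
module Submission where

open import Defs
open import Data.Nat using (ℕ)
open import Data.Rational using (ℚ; 1ℚ; _≤_; _*_)
open import Data.Nat as ℕ using (zero; suc)
import Data.Nat.Properties as ℕP
open import Data.Rational using (0ℚ; _+_; nonNegative)
import Data.Rational.Properties as ℚP
open import Data.Product using (_×_; _,_; proj₁; proj₂; ∃)
open import Data.Maybe using (Maybe; just; nothing)
open import Data.List using (List; []; _∷_)
open import Data.List.Relation.Unary.Any using (here; there)
open import Data.List.Membership.Propositional.Properties using (∈-filter⁻; ∈-filter⁺)
open import Data.Empty using (⊥-elim)
open import Relation.Nullary using (yes; no; _×-dec_)
open import Relation.Binary.PropositionalEquality using (_≡_; refl; sym; trans; cong; subst)

follow≡just⇒ : ∀ c J t j → follow c J t ≡ just j → c t ≡ just j × j ∈ J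
follow≡just⇒ c J t j eq with c t
follow≡just⇒ c J t j () | nothing
... | just k with k ∈? J
follow≡just⇒ c J t j refl | just k | yes k∈J = refl , k∈J
follow≡just⇒ c J t j ()   | just k | no _

wtM-follow-nonNeg : ∀ c J t → (∀ j → j ∈ J → 0ℚ ≤ wt j) → 0ℚ ≤ wtM (follow c J t)
wtM-follow-nonNeg c J t nonNeg with follow c J t in eq
... | nothing = ℚP.≤-refl
... | just j  = nonNeg j (proj₂ (follow≡just⇒ c J t j eq))

Wupto-nonNeg : ∀ n S → (∀ t → 0ℚ ≤ wtM (S t)) → 0ℚ ≤ Wupto n S
Wupto-nonNeg zero    S nonNeg = ℚP.≤-refl
Wupto-nonNeg (suc n) S nonNeg = ℚP.+-mono-≤ (Wupto-nonNeg n S nonNeg) (nonNeg n)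

released≤⊆ : ∀ t J {j} → j ∈ released≤ t J → j ∈ J
released≤⊆ t J j∈ = proj₁ (∈-filter⁻ (λ j → rel j ℕ.≤? t) j∈)

WellFormed-released≤ : ∀ t J → WellFormed J → WellFormed (released≤ t J)
WellFormed-released≤ t J (nonNeg , distinct) =
  (λ j j∈ → nonNeg j (released≤⊆ t J j∈)) ,
  (λ j j' j∈ j'∈ → distinct j j' (released≤⊆ t J j∈) (released≤⊆ t J j'∈))

Feasible-released≤ : ∀ t J S → Feasible (suc t) J S → Feasible (suc t) (released≤ t J) S
Feasible-released≤ t J S (valid , once) = valid′ , once
  where
  valid′ : ∀ t' j → S t' ≡ just j →
           (j ∈ released≤ t J) × (rel j ℕ.≤ t') × (t' ℕ.< dl j) × (t' ℕ.< suc t)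
  valid′ t' j eq with valid t' j eq
  ... | j∈J , r≤t' , t'<d , t'<1+t =
    ∈-filter⁺ (λ j → rel j ℕ.≤? t) j∈J (ℕP.≤-trans r≤t' (ℕP.≤-pred t'<1+t)) , r≤t' , t'<d , t'<1+t

_∷?_ : Maybe Job → List Job → List Job
nothing ∷? P = P
just j  ∷? P = j ∷ P

Wset-∷? : ∀ m P → Wset (m ∷? P) ≡ Wset P + wtM m
Wset-∷? nothing  P = sym (ℚP.+-identityʳ (Wset P))
Wset-∷? (just j) P = ℚP.+-comm (wt j) (Wset P)

module FollowPrediction (T : ℕ) (J Ĵ : Instance) (alg opt : Instance → Sched) (ρ : ℚ) where
  open LAP T J Ĵ alg opt ρ

  step-accept : ∀ t P j → ŜJ t ≡ just j → j ∉ P → optW t ≤ ρ * (Wset P + wt j) →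
                step t P ≡ j ∷ P
  step-accept t P j eq j∉P test rewrite eq
    with j ∉? P ×-dec (optW t ℚP.≤? ρ * (Wset P + wt j))
  ... | yes _ = refl
  ... | no ¬p = ⊥-elim (¬p (j∉P , test))

  step-idle : ∀ t P → ŜJ t ≡ nothing → optW t ≤ ρ * Wset P → step t P ≡ P
  step-idle t P eq test rewrite eq with optW t ℚP.≤? ρ * Wset P
  ... | yes _ = refl
  ... | no ¬p = ⊥-elim (¬p test)

  predicted : ℕ → List Job
  predicted zero    = []
  predicted (suc n) = ŜJ n ∷? predicted n

  Wset-predicted : ∀ n → Wset (predicted n) ≡ Wupto n ŜJ
  Wset-predicted zero    = refl
  Wset-predicted (suc n) =
    trans (Wset-∷? (ŜJ n) (predicted n)) (cong (_+ wtM (ŜJ n)) (Wset-predicted n))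

  earlier : ∀ {n j} → (∃ λ t → (t ℕ.< n) × (ŜJ t ≡ just j)) →
            ∃ λ t → (t ℕ.< suc n) × (ŜJ t ≡ just j)
  earlier (t , t<n , e) = t , ℕP.m<n⇒m<1+n t<n , e

  predicted-scheduled : ∀ n j → j ∈ predicted n → ∃ λ t → (t ℕ.< n) × (ŜJ t ≡ just j)
  predicted-scheduled zero    j ()
  predicted-scheduled (suc n) j j∈ with ŜJ n in eq
  ... | nothing = earlier (predicted-scheduled n j j∈)
  ... | just k with j∈
  ...   | here refl = n , ℕP.n<1+n n , eq
  ...   | there j∈′ = earlier (predicted-scheduled n j j∈′)

  module _ (Ŝ-feasible : Feasible T Ĵ Ŝ)
           (test-passes : ∀ n → n ℕ.< T → optW n ≤ ρ * W≤ n ŜJ) where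

    predicted-fresh : ∀ n j → ŜJ n ≡ just j → j ∉ predicted n
    predicted-fresh n j eq j∈ with predicted-scheduled n j j∈
    ... | t , t<n , e =
      ℕP.<-irrefl (proj₂ Ŝ-feasible t n j (proj₁ (follow≡just⇒ Ŝ J t j e))
                                            (proj₁ (follow≡just⇒ Ŝ J n j eq))) t<n

    step-follows : ∀ n m → ŜJ n ≡ m → optW n ≤ ρ * Wset (m ∷? predicted n) →
                   step n (predicted n) ≡ m ∷? predicted n
    step-follows n nothing  eq test = step-idle n (predicted n) eq test
    step-follows n (just j) eq test =
      step-accept n (predicted n) j eq (predicted-fresh n j eq)
        (subst (λ x → optW n ≤ ρ * x) (ℚP.+-comm (wt j) (Wset (predicted n))) test)

    run≡predicted : ∀ n → n ℕ.≤ T → run n ≡ predicted n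
    run≡predicted zero    _   = refl
    run≡predicted (suc n) n<T rewrite run≡predicted n (ℕP.<⇒≤ n<T) =
      step-follows n (ŜJ n) refl
        (subst (λ x → optW n ≤ ρ * x) (sym (Wset-predicted (suc n))) (test-passes n n<T))

    Wset-output : Wset output ≡ W T ŜJ
    Wset-output = trans (cong Wset (run≡predicted T ℕP.≤-refl)) (Wset-predicted T)

W-opt≤W≤-released : ∀ t J (opt : Instance → Sched) → WellFormed J → IsCanonicalOpt (suc t) opt →
  W (suc t) (opt J) ≤ W≤ t (opt (released≤ t J))
W-opt≤W≤-released t J opt wfJ canonOpt =
  proj₂ (proj₁ (canonOpt (released≤ t J) (WellFormed-released≤ t J wfJ))) (opt J)
    (Feasible-released≤ t J (opt J) (proj₁ (proj₁ (canonOpt J wfJ))))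

W-opt≤ratio : ∀ T J (opt : Instance → Sched) (S : Sched) (η : ℚ) →
  WellFormed J → IsCanonicalOpt T opt →
  (∀ t → t ℕ.< T → W≤ t (opt (released≤ t J)) ≤ η * W≤ t S) →
  W T (opt J) ≤ η * W T S
W-opt≤ratio zero    J opt S η wfJ canonOpt ratio = ℚP.≤-reflexive (sym (ℚP.*-zeroʳ η))
W-opt≤ratio (suc t) J opt S η wfJ canonOpt ratio =
  ℚP.≤-trans (W-opt≤W≤-released t J opt wfJ canonOpt) (ratio t (ℕP.n<1+n t))

lemma4 : (T : ℕ) (J Ĵ : Instance) (alg opt : Instance → Sched) (ρ η : ℚ) →
    WellFormed J → WellFormed Ĵ →
    IsCanonicalOpt T opt → IsOnlineAlg T alg →
    1ℚ ≤ ρ →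
    IsMaxRatio T (λ t → W≤ t (opt (released≤ t J))) (λ t → W≤ t (follow (opt Ĵ) J)) η →
    η ≤ ρ →
    W T (opt J) ≤ η * Wset (LAPoutput T J Ĵ alg opt ρ)
lemma4 T J Ĵ alg opt ρ η wfJ wfĴ canonOpt _ _ (_ , ratio≤η , _) η≤ρ = begin
  W T (opt J)                        ≤⟨ W-opt≤ratio T J opt ŜJ η wfJ canonOpt ratio≤η ⟩
  η * W T ŜJ                         ≡⟨ cong (η *_) (sym (Wset-output Ŝ-feasible test-passes)) ⟩
  η * Wset (LAPoutput T J Ĵ alg opt ρ) ∎
  where
  open LAP T J Ĵ alg opt ρ
  open FollowPrediction T J Ĵ alg opt ρ
  open ℚP.≤-Reasoning

  Ŝ-feasible : Feasible T Ĵ Ŝ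
  Ŝ-feasible = proj₁ (proj₁ (canonOpt Ĵ wfĴ))

  test-passes : ∀ n → n ℕ.< T → optW n ≤ ρ * W≤ n ŜJ
  test-passes n n<T = ℚP.≤-trans (ratio≤η n n<T)
    (ℚP.*-monoʳ-≤-nonNeg (W≤ n ŜJ) {{nonNegative W≤-nonNeg}} η≤ρ)
    where
    W≤-nonNeg : 0ℚ ≤ W≤ n ŜJ
    W≤-nonNeg = Wupto-nonNeg (suc n) ŜJ (λ t → wtM-follow-nonNeg Ŝ J t (proj₁ wfJ))
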